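{- Let $G=(V,E)$ be a finite simple undirected graph and $v\in V$. There do not exist two lossless summaries $\mathcal{G}_1,\mathcal{G}_2$ of $G$ such that $v$ belongs to a clique supernode of $\mathcal{G}_1$ and to an independent set supernode of $\mathcal{G}_2$.
   Context: A summary of $G$ is a pair $\mathcal{G}=(\mathcal{V},\mathcal{E})$ where $\mathcal{V}$ is a partition of $V$ into nonempty sets called supernodes and $\mathcal{E}$ is a set of unordered pairs $\{S_i,S_j\}$ of supernodes ($i=j$ allowed, a self-loop), called superedges. Its reconstruction is the simple graph on $V$ containing, for each superedge $\{S_i,S_j\}$ with $i\ne j$, all pairs $\{u,w\}$ with $u\in S_i,w\in S_j$, and for each self-loop $\{S_i,S_i\}$, all pairs of distinct nodes of $S_i$. The summary is lossless if its reconstruction equals $G$. A clique supernode is a supernode of size at least two all of whose nodes are pairwise adjacent in $G$; an independent set supernode is a supernode of size at least two no two of whose nodes are adjacent in $G$. -}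

module Defs where

open import Data.Nat using (ℕ)
open import Data.Fin using (Fin)
open import Data.Bool using (Bool; true; false)
open import Data.Product using (Σ; ∃; ∃-syntax; _×_)
open import Relation.Binary.PropositionalEquality using (_≡_; _≢_)
open import Function.Definitions using (Surjective)

record Graph (n : ℕ) : Set where
  field
    adj    : Fin n → Fin n → Bool
    sym    : ∀ u w → adj u w ≡ adj w u
    irrefl : ∀ u → adj u u ≡ false
open Graph public

-- The partition V = S_0 ∪ … ∪ S_{k-1} is given by the map  node : Fin n → Fin k
-- (u ∈ S_i  iff  node u ≡ i); surjectivity says every supernode is nonempty.
-- The superedge set (unordered pairs {S_i,S_j}, i = j allowed) is given by a
-- symmetric Boolean relation  superedge  on Fin k.
record Summary (n : ℕ) : Set where
  field
    k          : ℕ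
    node       : Fin n → Fin k
    nonempty   : Surjective _≡_ _≡_ node
    superedge  : Fin k → Fin k → Bool
    superSym   : ∀ i j → superedge i j ≡ superedge j i
open Summary public

Reconstructs : ∀ {n} → Summary n → Fin n → Fin n → Bool
Reconstructs S u w = superedge S (node S u) (node S w)

-- Lossless: the reconstruction equals G (on all pairs of distinct nodes;
-- neither graph has loops).
Lossless : ∀ {n} → Graph n → Summary n → Set
Lossless G S = ∀ u w → u ≢ w → adj G u w ≡ Reconstructs S u w

AtLeastTwo : ∀ {n} (S : Summary n) → Fin (k S) → Set
AtLeastTwo S i = ∃[ u ] ∃[ w ] (u ≢ w × node S u ≡ i × node S w ≡ i)

CliqueSupernode : ∀ {n} → Graph n → (S : Summary n) → Fin (k S) → Set
CliqueSupernode G S i =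
  AtLeastTwo S i ×
  (∀ u w → node S u ≡ i → node S w ≡ i → u ≢ w → adj G u w ≡ true)

IndependentSupernode : ∀ {n} → Graph n → (S : Summary n) → Fin (k S) → Set
IndependentSupernode G S i =
  AtLeastTwo S i ×
  (∀ u w → node S u ≡ i → node S w ≡ i → adj G u w ≡ false)

module Submission where

open import Defs
open import Data.Fin using (Fin; _≟_)
open import Data.Bool using (true; false)
open import Data.Product using (_×_; _,_; ∃-syntax)
open import Relation.Nullary using (¬_; yes; no)
open import Relation.Binary.PropositionalEquality
  using (_≡_; _≢_; refl; trans; cong; ≢-sym; module ≡-Reasoning)
  renaming (sym to ≡-sym)

-- In a lossless summary two nodes of the same supernode have the
-- same neighbours apart from each other. Take a ≠ v in v's clique supernode
-- and b ≠ v in v's independent set supernode; then a ≠ b, and a, b are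
-- adjacent because b mimics v (adjacent to a) and non-adjacent because
-- a mimics v (non-adjacent to b).

true≢false : true ≢ false
true≢false ()

another-member : ∀ {n} (S : Summary n) (v : Fin n) → AtLeastTwo S (node S v) →
  ∃[ a ] (a ≢ v × node S a ≡ node S v)
another-member S v (u , w , u≢w , u∈ , w∈) with u ≟ v
... | no u≢v = u , u≢v , u∈
... | yes refl = w , ≢-sym u≢w , w∈

lossless-twins : ∀ {n} (G : Graph n) (S : Summary n) → Lossless G S →
  ∀ {u u′ w} → node S u ≡ node S u′ → u ≢ w → u′ ≢ w →
  adj G u w ≡ adj G u′ w
lossless-twins G S lossless {u} {u′} {w} same u≢w u′≢w = begin
  adj G u w                                ≡⟨ lossless u w u≢w ⟩
  superedge S (node S u) (node S w)        ≡⟨ cong (λ i → superedge S i (node S w)) same ⟩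
  superedge S (node S u′) (node S w)       ≡⟨ ≡-sym (lossless u′ w u′≢w) ⟩
  adj G u′ w                               ∎
  where open ≡-Reasoning

lemma3p2 : ∀ {n} (G : Graph n) (v : Fin n) (S₁ S₂ : Summary n) →
    Lossless G S₁ → Lossless G S₂ →
    ¬ (CliqueSupernode G S₁ (node S₁ v) × IndependentSupernode G S₂ (node S₂ v))
lemma3p2 G v S₁ S₂ L₁ L₂ ((two₁ , clique) , (two₂ , independent))
  with another-member S₁ v two₁ | another-member S₂ v two₂
... | a , a≢v , a∈ | b , b≢v , b∈ = true≢false (begin
  true       ≡⟨ ≡-sym v∼a ⟩
  adj G v a  ≡⟨ ≡-sym (lossless-twins G S₂ L₂ b∈ (≢-sym a≢b) (≢-sym a≢v)) ⟩
  adj G b a  ≡⟨ Graph.sym G b a ⟩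
  adj G a b  ≡⟨ lossless-twins G S₁ L₁ a∈ a≢b (≢-sym b≢v) ⟩
  adj G v b  ≡⟨ v≁b ⟩
  false      ∎)
  where
  open ≡-Reasoning
  v∼a : adj G v a ≡ true
  v∼a = clique v a refl a∈ (≢-sym a≢v)
  v≁b : adj G v b ≡ false
  v≁b = independent v b refl b∈
  a≢b : a ≢ b
  a≢b refl = true≢false (trans (≡-sym v∼a) v≁b)
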